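{- Let integers $P>Q\ge 1$ and positive integers $a,b,c,d$ be such that $a<b<c<d\le 2a$ and the integers $k_1a+k_2b+k_3c+k_4d$, over all tuples with $k_1,k_2\in\mathbb{Z}\cap[-3P,3P]$, $k_3\in\mathbb{Z}\cap[0,2Q]$, $k_4\in\{0,1\}$, are pairwise distinct. Let $M=Pa+Qc+d$ and define the size profiles $S_{i,j}$ ($0\le i\le P$, $0\le j\le Q$) as below. Let $\phi$ and $\phi'$ be full memory states with size profiles $S_{i,j}$ and $S_{i',j'}$ respectively, and let $[L,R)$ be a maximal changed interval between $\phi$ and $\phi'$. If $[L,R)$ in $\phi$ does not contain the finger object of $S_{i,j}$, then the multiset of sizes of the objects of $\phi'$ lying in $[L,R)$ equals the multiset of sizes of the objects of $\phi$ lying in $[L,R)$ (in particular, $[L,R)$ in $\phi'$ does not contain the finger object of $S_{i',j'}$).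
   Context: For $0\le i\le P$, $0\le j\le Q$, $S_{i,j}$ is the multiset of object sizes consisting of $i$ objects of size $a$, $j$ objects of size $c$, $h=\lfloor(M-d-ia-jc)/b\rfloor$ objects of size $b$, and one distinguished finger object of size $M-ia-jc-hb$ (which lies in $[d,d+b)$); its total size is $M$. A full memory state with size profile $S$ is an arrangement of objects with sizes given by the multiset $S$ in the memory $[0,M)$ (slots $0,\dots,M-1$) with no gaps, described by the left-to-right list of object sizes; an object of size $s$ at location $p$ occupies $[p,p+s)$. For two full memory states $\phi,\phi'$, an object of size $s$ at location $p$ in $\phi$ is unchanged if $\phi'$ also has an object of size $s$ at location $p$, and changed otherwise (symmetrically for $\phi'$). A maximal changed interval is an inclusion-maximal interval $[L,R)\subseteq[0,M)$ such that every object of $\phi$ intersecting it is changed; $[0,M)$ is the disjoint union of the unchanged objects and the maximal changed intervals, so each maximal changed interval is exactly tiled by objects of $\phi$ and also by objects of $\phi'$. -}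

module Defs where

open import Data.Nat using (ℕ; zero; suc; _+_; _*_; _∸_; _≤_; _<_; NonZero)
open import Data.Nat.DivMod using (_/_)
open import Data.List using (List; []; _∷_; _++_; [_]; replicate; map)
open import Data.List.Membership.Propositional using (_∈_)
open import Data.List.Relation.Unary.Any using (Any)
open import Data.List.Relation.Binary.Permutation.Propositional using (_↭_)
open import Data.List.Relation.Unary.All using (All)
open import Data.List using (filter)
open import Data.Product using (_×_; _,_; ∃; ∃-syntax; proj₁; proj₂)
open import Relation.Nullary using (¬_)
open import Relation.Binary.PropositionalEquality using (_≡_)
open import Relation.Nullary.Decidable using (_×-dec_)
open import Data.Nat using (_≤?_)

memSize : (P Q a c d : ℕ) → ℕ
memSize P Q a c d = P * a + Q * c + d

hCount : (M a b c d i j : ℕ) → .{{NonZero b}} → ℕ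
hCount M a b c d i j = (M ∸ d ∸ i * a ∸ j * c) / b

fingerSize : (M a b c d i j : ℕ) → .{{NonZero b}} → ℕ
fingerSize M a b c d i j = M ∸ i * a ∸ j * c ∸ hCount M a b c d i j * b

-- the size profile S_{i,j} as a list (multiset up to permutation);
-- the finger object is the last entry
profile : (M a b c d i j : ℕ) → .{{NonZero b}} → List ℕ
profile M a b c d i j =
  replicate i a ++ replicate j c ++ replicate (hCount M a b c d i j) b
    ++ [ fingerSize M a b c d i j ]

-- A full memory state is the left-to-right list of object sizes.
-- It has size profile S when its list of sizes is a permutation of S.
HasProfile : List ℕ → List ℕ → Set
HasProfile φ S = φ ↭ S

objectsFrom : ℕ → List ℕ → List (ℕ × ℕ)
objectsFrom p [] = []
objectsFrom p (s ∷ φ) = (p , s) ∷ objectsFrom (p + s) φ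

objects : List ℕ → List (ℕ × ℕ)
objects = objectsFrom 0

Unchanged : List ℕ → ℕ × ℕ → Set
Unchanged φ' o = o ∈ objects φ'

Changed : List ℕ → ℕ × ℕ → Set
Changed φ' o = ¬ Unchanged φ' o

Intersects : ℕ × ℕ → ℕ → ℕ → Set
Intersects (p , s) L R = (L < p + s) × (p < R)

LiesIn : ℕ × ℕ → ℕ → ℕ → Set
LiesIn (p , s) L R = (L ≤ p) × (p + s ≤ R)

ChangedInterval : ℕ → List ℕ → List ℕ → ℕ → ℕ → Set
ChangedInterval M φ φ' L R =
  (L < R) × (R ≤ M) ×
  (∀ o → o ∈ objects φ → Intersects o L R → Changed φ' o)

MaximalChangedInterval : ℕ → List ℕ → List ℕ → ℕ → ℕ → Set
MaximalChangedInterval M φ φ' L R =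
  ChangedInterval M φ φ' L R ×
  (∀ L' R' → ChangedInterval M φ φ' L' R' → L' ≤ L → R ≤ R' → (L' ≡ L) × (R' ≡ R))

sizesIn : List ℕ → ℕ → ℕ → List ℕ
sizesIn φ L R =
  map proj₂ (filter (λ o → (L ≤? proj₁ o) ×-dec (proj₁ o + proj₂ o ≤? R)) (objects φ))

-- [L,R) in φ contains the finger object (the unique object of size f,
-- since f ≥ d > c > b > a)
ContainsFinger : List ℕ → ℕ → ℕ → ℕ → Set
ContainsFinger φ f L R = ∃[ p ] ((p , f) ∈ objects φ × LiesIn (p , f) L R)

{-# OPTIONS --safe #-}
module Submission where

-- Maximality forces L and R to be object boundaries in both states: an object of φ
-- straddling an endpoint, or a changed one adjacent to it, would widen the interval,
-- and an unchanged adjacent one is also an object of φ′. Hence φ and φ′ tile [L, R)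
-- exactly, by sub-multisets X of S_{i,j} and Y of S_{i′,j′} of equal total size.
-- X has no finger, so its total is x_a a + x_b b + x_c c with small coefficients. If Y
-- contained the finger, X together with the part of S_{i′,j′} missing from Y would
-- consist of objects of sizes a, b, c only and yet have total size M = P a + Q c + d,
-- against distinctness; so Y has no finger either, and distinctness forces the
-- numbers of a-, b- and c-objects to agree.

open import Data.Empty using (⊥-elim)
open import Data.Integer using (ℤ; +_; -_; _-_; ∣_∣) renaming (_+_ to _+ℤ_; _*_ to _*ℤ_)
open import Data.Integer.Properties using (pos-+; pos-*; +-injective; ∣-i∣≡∣i∣)
import Data.Integer.Tactic.RingSolver as ℤ-Solver
open import Data.List using (List; []; _∷_; _++_; [_]; replicate; map; filter; concatMap)
open import Data.List.Properties
  using (∷-injective; ++-assoc; ++-identityʳ; ++-cancelˡ; ++-conicalˡ; filter-++; filter-all; filter-none)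
open import Data.List.Membership.Propositional using (_∈_; _∉_)
open import Data.List.Membership.Propositional.Properties using (∈-++⁺ʳ; ∈-++⁻; ∈-∃++; ∈-map⁻; ∈-filter⁻)
import Data.List.Membership.DecPropositional as DecMembership
open import Data.List.Relation.Binary.Permutation.Propositional using (_↭_; prep; ↭-refl; ↭-sym; ↭-trans)
open import Data.List.Relation.Binary.Permutation.Propositional.Properties
  using (All-resp-↭; ∈-resp-↭; ↭-empty-inv; ++⁺ˡ; ++⁺ʳ; shift; shifts; drop-∷)
open import Data.List.Relation.Binary.Pointwise using (Pointwise; []; _∷_)
open import Data.List.Relation.Unary.All using (All; []; _∷_)
import Data.List.Relation.Unary.All as All
import Data.List.Relation.Unary.All.Properties as All
open import Data.List.Relation.Unary.Any using (here; there)
open import Data.Nat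
open import Data.Nat.DivMod using (m/n*n≤m)
open import Data.Nat.ListAction using (sum)
open import Data.Nat.ListAction.Properties using (sum-++; sum-↭)
open import Data.Nat.Properties
open import Data.Nat.Tactic.RingSolver using (solve-∀)
open import Data.Product using (_×_; _,_; proj₁; proj₂; ∃-syntax; ∃₂; uncurry)
open import Data.Product.Properties using (≡-dec)
open import Data.Sum using (_⊎_; inj₁; inj₂)
open import Defs
open import Function using (_∘_)
open import Relation.Binary.PropositionalEquality
  using (_≡_; _≢_; refl; sym; trans; cong; cong₂; subst; module ≡-Reasoning)
open import Relation.Nullary using (¬_; Dec; yes; no; contradiction)
open import Relation.Nullary.Decidable using (_×-dec_)

-- Sub-multisets

infix 4 _⊑_

_⊑_ : List ℕ → List ℕ → Set
X ⊑ Z = ∃[ W ] X ++ W ↭ Z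

⊑-respʳ-↭ : ∀ {X Y Z} → X ⊑ Y → Y ↭ Z → X ⊑ Z
⊑-respʳ-↭ (W , X++W↭Y) Y↭Z = W , ↭-trans X++W↭Y Y↭Z

∈⇒↭∷ : ∀ {v : ℕ} {X} → v ∈ X → ∃[ X₀ ] X ↭ v ∷ X₀
∈⇒↭∷ {v} v∈X with X₁ , X₂ , refl ← ∈-∃++ v∈X = X₁ ++ X₂ , shift v X₁ X₂

-- The first copy of v on the right lies either in X or in the complement W.
⊑-replicate-++ : ∀ n {v X Z} → X ⊑ replicate n v ++ Z →
  ∃[ m ] m ≤ n × ∃[ X₀ ] X ↭ replicate m v ++ X₀ × X₀ ⊑ Z
⊑-replicate-++ zero X⊑Z = 0 , z≤n , _ , ↭-refl , X⊑Z
⊑-replicate-++ (suc n) {v} {X} (W , X++W↭) with ∈-++⁻ X (∈-resp-↭ (↭-sym X++W↭) (here refl))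
... | inj₁ v∈X =
  let X₀ , X↭ = ∈⇒↭∷ v∈X
      m , m≤n , X₁ , X₀↭ , X₁⊑ = ⊑-replicate-++ n (W , drop-∷ (↭-trans (↭-sym (++⁺ʳ W X↭)) X++W↭))
  in suc m , s≤s m≤n , X₁ , ↭-trans X↭ (prep v X₀↭) , X₁⊑
... | inj₂ v∈W =
  let W₀ , W↭ = ∈⇒↭∷ v∈W
      m , m≤n , X₁ , X↭ , X₁⊑ = ⊑-replicate-++ n (W₀ , drop-∷ (↭-trans (↭-sym (↭-trans (++⁺ˡ X W↭) (shift v X W₀))) X++W↭))
  in m , m≤n⇒m≤1+n m≤n , X₁ , X↭ , X₁⊑

expand : List (ℕ × ℕ) → List ℕ
expand = concatMap (uncurry replicate)

_≤ʳ_ : ℕ × ℕ → ℕ × ℕ → Set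
(m , v) ≤ʳ (n , w) = m ≤ n × v ≡ w

⊑-expand : ∀ rs {X} → X ⊑ expand rs → ∃[ ms ] Pointwise _≤ʳ_ ms rs × X ↭ expand ms
⊑-expand [] {X} (W , X++W↭[]) with refl ← ++-conicalˡ X W (↭-empty-inv X++W↭[]) = [] , [] , ↭-refl
⊑-expand ((n , v) ∷ rs) X⊑ =
  let m , m≤n , X₀ , X↭ , X₀⊑ = ⊑-replicate-++ n X⊑
      ms , ms≤rs , X₀↭ = ⊑-expand rs X₀⊑
  in (m , v) ∷ ms , (m≤n , refl) ∷ ms≤rs , ↭-trans X↭ (++⁺ˡ (replicate m v) X₀↭)

sum-replicate : ∀ n v → sum (replicate n v) ≡ n * v
sum-replicate zero    v = refl
sum-replicate (suc n) v = cong (_+_ v) (sum-replicate n v)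

sum-expand : ∀ rs → sum (expand rs) ≡ sum (map (uncurry _*_) rs)
sum-expand [] = refl
sum-expand ((n , v) ∷ rs) = trans (sum-++ (replicate n v) (expand rs)) (cong₂ _+_ (sum-replicate n v) (sum-expand rs))

sum-↭-expand : ∀ {X} rs → X ↭ expand rs → sum X ≡ sum (map (uncurry _*_) rs)
sum-↭-expand rs X↭ = trans (sum-↭ X↭) (sum-expand rs)

All-expand : ∀ {P : ℕ → Set} rs → All (P ∘ proj₂) rs → All P (expand rs)
All-expand [] [] = []
All-expand ((n , v) ∷ rs) (pv ∷ prs) = All.++⁺ (All.replicate⁺ n pv) (All-expand rs prs)

-- Memory layout

start end : ℕ × ℕ → ℕ
start = proj₁
end (p , s) = p + s

liesIn? : ∀ L R (o : ℕ × ℕ) → Dec (LiesIn o L R)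
liesIn? L R o = (L ≤? proj₁ o) ×-dec (proj₁ o + proj₂ o ≤? R)

objectsFrom-++ : ∀ p A B → objectsFrom p (A ++ B) ≡ objectsFrom p A ++ objectsFrom (p + sum A) B
objectsFrom-++ p []      B = cong (λ q → objectsFrom q B) (sym (+-identityʳ p))
objectsFrom-++ p (s ∷ A) B = cong ((p , s) ∷_) (begin
  objectsFrom (p + s) (A ++ B)                              ≡⟨ objectsFrom-++ (p + s) A B ⟩
  objectsFrom (p + s) A ++ objectsFrom (p + s + sum A) B    ≡⟨ cong (λ q → objectsFrom (p + s) A ++ objectsFrom q B) (+-assoc p s (sum A)) ⟩
  objectsFrom (p + s) A ++ objectsFrom (p + (s + sum A)) B  ∎)
  where open ≡-Reasoning

map-proj₂-objectsFrom : ∀ p φ → map proj₂ (objectsFrom p φ) ≡ φ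
map-proj₂-objectsFrom p []      = refl
map-proj₂-objectsFrom p (s ∷ φ) = cong (s ∷_) (map-proj₂-objectsFrom (p + s) φ)

∈-objectsFrom⁺ : ∀ p A t B → (p + sum A , t) ∈ objectsFrom p (A ++ t ∷ B)
∈-objectsFrom⁺ p []      t B = here (cong (_, t) (+-identityʳ p))
∈-objectsFrom⁺ p (s ∷ A) t B =
  there (subst (λ q → (q , t) ∈ objectsFrom (p + s) (A ++ t ∷ B)) (+-assoc p s (sum A)) (∈-objectsFrom⁺ (p + s) A t B))

∈-objectsFrom⁻ : ∀ {p q t} φ → (q , t) ∈ objectsFrom p φ → ∃₂ λ A B → φ ≡ A ++ t ∷ B × q ≡ p + sum A
∈-objectsFrom⁻ {p} (s ∷ φ) (here refl) = [] , φ , refl , sym (+-identityʳ p)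
∈-objectsFrom⁻ {p} (s ∷ φ) (there o∈) with A , B , refl , refl ← ∈-objectsFrom⁻ φ o∈ =
  s ∷ A , B , refl , +-assoc p s (sum A)

start-objectsFrom : ∀ {p o} φ → o ∈ objectsFrom p φ → p ≤ start o
start-objectsFrom     (s ∷ φ) (here refl) = ≤-refl
start-objectsFrom {p} (s ∷ φ) (there o∈)  = ≤-trans (m≤m+n p s) (start-objectsFrom φ o∈)

end-objectsFrom : ∀ {p o} φ → o ∈ objectsFrom p φ → end o ≤ p + sum φ
end-objectsFrom {p}     (s ∷ φ) (here refl) = +-monoʳ-≤ p (m≤m+n s (sum φ))
end-objectsFrom {p} {o} (s ∷ φ) (there o∈)  = subst (end o ≤_) (+-assoc p s (sum φ)) (end-objectsFrom φ o∈)

start<end-objectsFrom : ∀ {p o φ} → All (0 <_) φ → o ∈ objectsFrom p φ → start o < end o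
start<end-objectsFrom {o = q , t} (t>0 ∷ _) (here refl) = m<m+n q t>0
start<end-objectsFrom (_ ∷ pos) (there o∈) = start<end-objectsFrom pos o∈

objectsFrom-disjoint : ∀ {p o o′} φ → o ∈ objectsFrom p φ → o′ ∈ objectsFrom p φ →
  o ≡ o′ ⊎ end o ≤ start o′ ⊎ end o′ ≤ start o
objectsFrom-disjoint (s ∷ φ) (here refl) (here refl)  = inj₁ refl
objectsFrom-disjoint (s ∷ φ) (here refl) (there o′∈) = inj₂ (inj₁ (start-objectsFrom φ o′∈))
objectsFrom-disjoint (s ∷ φ) (there o∈)  (here refl)  = inj₂ (inj₂ (start-objectsFrom φ o∈))
objectsFrom-disjoint (s ∷ φ) (there o∈)  (there o′∈) = objectsFrom-disjoint φ o∈ o′∈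

BoundaryFrom : ℕ → List ℕ → ℕ → Set
BoundaryFrom p φ x = ∃₂ λ A B → φ ≡ A ++ B × p + sum A ≡ x

Boundary : List ℕ → ℕ → Set
Boundary = BoundaryFrom 0

boundary⊎inside : ∀ p φ {x} → p ≤ x → x ≤ p + sum φ →
  BoundaryFrom p φ x ⊎ ∃[ o ] o ∈ objectsFrom p φ × start o < x × x < end o
boundary⊎inside p [] p≤x x≤p+0 = inj₁ ([] , [] , refl , ≤-antisym (subst (_≤ _) (sym (+-identityʳ p)) p≤x) x≤p+0)
boundary⊎inside p (s ∷ φ) {x} p≤x x≤ with x ≟ p
... | yes refl = inj₁ ([] , s ∷ φ , refl , +-identityʳ p)
... | no x≢p with x <? p + s
...   | yes x<p+s = inj₂ ((p , s) , here refl , ≤∧≢⇒< p≤x (x≢p ∘ sym) , x<p+s)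
...   | no x≮p+s with boundary⊎inside (p + s) φ (≮⇒≥ x≮p+s) (subst (x ≤_) (sym (+-assoc p s (sum φ))) x≤)
...     | inj₁ (A , B , refl , e)  = inj₁ (s ∷ A , B , refl , trans (sym (+-assoc p s (sum A))) e)
...     | inj₂ (o , o∈ , inside) = inj₂ (o , there o∈ , inside)

start-boundary : ∀ {φ q t} → (q , t) ∈ objects φ → Boundary φ q
start-boundary {φ} o∈ with A , B , refl , refl ← ∈-objectsFrom⁻ φ o∈ = A , _ ∷ B , refl , refl

end-boundary : ∀ {φ q t} → (q , t) ∈ objects φ → Boundary φ (q + t)
end-boundary {φ} {t = t} o∈ with A , B , refl , refl ← ∈-objectsFrom⁻ φ o∈ =
  A ++ [ t ] , B , sym (++-assoc A [ t ] B) , trans (sum-++ A [ t ]) (cong (_+_ (sum A)) (+-identityʳ t))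

boundary⇒≡0⊎end : ∀ {φ x} → Boundary φ x → x ≡ 0 ⊎ ∃[ o ] o ∈ objects φ × end o ≡ x
boundary⇒≡0⊎end (A , B , refl , A-sum) = go 0 A A-sum
  where
  go : ∀ p A {x} → p + sum A ≡ x → x ≡ p ⊎ ∃[ o ] o ∈ objectsFrom p (A ++ B) × end o ≡ x
  go p []      e = inj₁ (trans (sym e) (+-identityʳ p))
  go p (s ∷ A) e with go (p + s) A (trans (+-assoc p s (sum A)) e)
  ... | inj₁ x≡p+s       = inj₂ ((p , s) , here refl , sym x≡p+s)
  ... | inj₂ (o , o∈ , e′) = inj₂ (o , there o∈ , e′)

boundary⇒≡sum⊎start : ∀ {φ x} → Boundary φ x → x ≡ sum φ ⊎ ∃[ t ] (x , t) ∈ objects φ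
boundary⇒≡sum⊎start (A , []    , refl , refl) = inj₁ (sym (trans (sum-++ A []) (+-identityʳ (sum A))))
boundary⇒≡sum⊎start (A , t ∷ B , refl , refl) = inj₂ (t , ∈-objectsFrom⁺ 0 A t B)

prefix-of-longer : ∀ A {B} C {D} → A ++ B ≡ C ++ D → sum A < sum C → ∃[ X ] C ≡ A ++ X
prefix-of-longer []      C        _  _ = C , refl
prefix-of-longer (s ∷ A) []       _  ()
prefix-of-longer (s ∷ A) (s′ ∷ C) eq lt with refl , eq′ ← ∷-injective eq
  with X , refl ← prefix-of-longer A C eq′ (+-cancelˡ-< s _ _ lt) = X , refl

sizesIn-infix : ∀ A X D → All (0 <_) (A ++ X ++ D) → sizesIn (A ++ X ++ D) (sum A) (sum A + sum X) ≡ X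
sizesIn-infix A X D pos = begin
  map proj₂ (filter inside? (objects (A ++ X ++ D)))
    ≡⟨ cong (map proj₂ ∘ filter inside?) (trans (objectsFrom-++ 0 A (X ++ D)) (cong (objectsFrom 0 A ++_) (objectsFrom-++ L X D))) ⟩
  map proj₂ (filter inside? (objectsFrom 0 A ++ objectsFrom L X ++ objectsFrom R D))
    ≡⟨ cong (map proj₂) (filter-++ inside? (objectsFrom 0 A) _) ⟩
  map proj₂ (filter inside? (objectsFrom 0 A) ++ filter inside? (objectsFrom L X ++ objectsFrom R D))
    ≡⟨ cong (λ ys → map proj₂ (filter inside? (objectsFrom 0 A) ++ ys)) (filter-++ inside? (objectsFrom L X) _) ⟩
  map proj₂ (filter inside? (objectsFrom 0 A) ++ filter inside? (objectsFrom L X) ++ filter inside? (objectsFrom R D))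
    ≡⟨ cong₂ (λ ys zs → map proj₂ (ys ++ filter inside? (objectsFrom L X) ++ zs)) before after ⟩
  map proj₂ (filter inside? (objectsFrom L X) ++ [])
    ≡⟨ cong (map proj₂) (trans (++-identityʳ _) (filter-all inside? within)) ⟩
  map proj₂ (objectsFrom L X)
    ≡⟨ map-proj₂-objectsFrom L X ⟩
  X ∎
  where
  open ≡-Reasoning
  L R : ℕ
  L = sum A
  R = sum A + sum X
  inside? : (o : ℕ × ℕ) → Dec (LiesIn o L R)
  inside? = liesIn? L R
  pos-X++D : All (0 <_) (X ++ D)
  pos-X++D = All.++⁻ʳ A pos
  before : filter inside? (objectsFrom 0 A) ≡ []
  before = filter-none inside? (All.tabulate λ o∈ (L≤start , _) →
    <⇒≱ (<-≤-trans (start<end-objectsFrom (All.++⁻ˡ A pos) o∈) (end-objectsFrom A o∈)) L≤start)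
  after : filter inside? (objectsFrom R D) ≡ []
  after = filter-none inside? (All.tabulate λ o∈ (_ , end≤R) →
    <⇒≱ (<-≤-trans (start<end-objectsFrom (All.++⁻ʳ X pos-X++D) o∈) end≤R) (start-objectsFrom D o∈))
  within : All (λ o → LiesIn o L R) (objectsFrom L X)
  within = All.tabulate λ o∈ → start-objectsFrom X o∈ , end-objectsFrom X o∈

sizesIn-between : ∀ {φ L R} → All (0 <_) φ → Boundary φ L → Boundary φ R → L < R →
  sizesIn φ L R ⊑ φ × L + sum (sizesIn φ L R) ≡ R
sizesIn-between pos (A , B , refl , refl) (C , D , eq , refl) L<R
  with X , refl ← prefix-of-longer A C eq L<R
  with refl ← ++-cancelˡ A B (X ++ D) (trans eq (++-assoc A X D))
  rewrite sum-++ A X | sizesIn-infix A X D pos = (A ++ D , shifts X A) , refl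

∈-sizesIn⁻ : ∀ {φ L R s} → s ∈ sizesIn φ L R → ∃[ p ] (p , s) ∈ objects φ × LiesIn (p , s) L R
∈-sizesIn⁻ {φ} {L} {R} s∈ with (p , _) , o∈ , refl ← ∈-map⁻ proj₂ s∈ =
  p , ∈-filter⁻ (liesIn? L R) o∈

-- Maximal changed intervals

Unchanged? : ∀ φ′ o → Dec (Unchanged φ′ o)
Unchanged? φ′ o = o ∈? objects φ′
  where open DecMembership (≡-dec _≟_ _≟_)

module _ {M φ φ′ L R} (pos : All (0 <_) φ) (sum-φ : sum φ ≡ M)
         (maximal : MaximalChangedInterval M φ φ′ L R) where

  private
    L<R : L < R
    L<R = proj₁ (proj₁ maximal)
    R≤M : R ≤ M
    R≤M = proj₁ (proj₂ (proj₁ maximal))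
    intersecting-changed : ∀ o → o ∈ objects φ → Intersects o L R → Changed φ′ o
    intersecting-changed = proj₂ (proj₂ (proj₁ maximal))
    widest : ∀ L′ R′ → ChangedInterval M φ φ′ L′ R′ → L′ ≤ L → R ≤ R′ → L′ ≡ L × R′ ≡ R
    widest = proj₂ maximal

  -- The union of [L, R) with a changed object touching it would be a wider changed interval.
  absorb : ∀ {o} → o ∈ objects φ → Changed φ′ o → start o ≤ R → L ≤ end o → L ≤ start o × end o ≤ R
  absorb {o} o∈ o-changed o≤R L≤o = m⊓n≡n⇒n≤m (proj₁ same) , m⊔n≡m⇒n≤m (proj₂ same)
    where
    changed : ∀ o′ → o′ ∈ objects φ → Intersects o′ (start o ⊓ L) (R ⊔ end o) → Changed φ′ o′
    changed o′ o′∈ (lo<o′ , o′<hi) with objectsFrom-disjoint φ o∈ o′∈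
    ... | inj₁ refl = o-changed
    ... | inj₂ (inj₁ o≤o′) = intersecting-changed o′ o′∈
      ( ≤-<-trans (≤-trans L≤o o≤o′) (start<end-objectsFrom pos o′∈)
      , ≰⇒> (λ R≤o′ → <⇒≱ o′<hi (⊔-lub R≤o′ o≤o′)))
    ... | inj₂ (inj₂ o′≤o) = intersecting-changed o′ o′∈
      ( ≰⇒> (λ o′≤L → <⇒≱ lo<o′ (⊓-glb o′≤o o′≤L))
      , <-≤-trans (start<end-objectsFrom pos o′∈) (≤-trans o′≤o o≤R))
    widened : ChangedInterval M φ φ′ (start o ⊓ L) (R ⊔ end o)
    widened = ≤-<-trans (m⊓n≤n _ L) (<-≤-trans L<R (m≤m⊔n R _))
            , ⊔-lub R≤M (subst (end o ≤_) sum-φ (end-objectsFrom φ o∈))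
            , changed
    same : start o ⊓ L ≡ L × R ⊔ end o ≡ R
    same = widest (start o ⊓ L) (R ⊔ end o) widened (m⊓n≤n _ L) (m≤m⊔n R _)

  absorb-intersecting : ∀ {o} → o ∈ objects φ → Intersects o L R → L ≤ start o × end o ≤ R
  absorb-intersecting {o} o∈ (L<o , o<R) = absorb o∈ (intersecting-changed o o∈ (L<o , o<R)) (<⇒≤ o<R) (<⇒≤ L<o)

  L-boundary : Boundary φ L
  L-boundary with boundary⊎inside 0 φ z≤n (≤-trans (<⇒≤ L<R) (subst (R ≤_) (sym sum-φ) R≤M))
  ... | inj₁ L-bdry = L-bdry
  ... | inj₂ (o , o∈ , o<L , L<o) = contradiction (proj₁ (absorb-intersecting o∈ (L<o , <-trans o<L L<R))) (<⇒≱ o<L)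

  R-boundary : Boundary φ R
  R-boundary with boundary⊎inside 0 φ z≤n (subst (R ≤_) (sym sum-φ) R≤M)
  ... | inj₁ R-bdry = R-bdry
  ... | inj₂ (o , o∈ , o<R , R<o) = contradiction (proj₂ (absorb-intersecting o∈ (<-trans L<R R<o , o<R))) (<⇒≱ R<o)

  L-boundary′ : Boundary φ′ L
  L-boundary′ with boundary⇒≡0⊎end L-boundary
  ... | inj₁ L≡0 = [] , φ′ , refl , sym L≡0
  ... | inj₂ (o , o∈ , o≡L) with Unchanged? φ′ o
  ...   | yes o∈′ = subst (Boundary φ′) o≡L (end-boundary o∈′)
  ...   | no o-changed = contradiction (subst (_≤ start o) (sym o≡L) L≤o) (<⇒≱ (start<end-objectsFrom pos o∈))
    where
    L≤o : L ≤ start o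
    L≤o = proj₁ (absorb o∈ o-changed (≤-trans (m≤m+n _ _) (subst (_≤ R) (sym o≡L) (<⇒≤ L<R))) (≤-reflexive (sym o≡L)))

  R-boundary′ : sum φ′ ≡ M → Boundary φ′ R
  R-boundary′ sum-φ′ with boundary⇒≡sum⊎start R-boundary
  ... | inj₁ R≡sum = φ′ , [] , sym (++-identityʳ φ′) , trans sum-φ′ (trans (sym sum-φ) (sym R≡sum))
  ... | inj₂ (t , o∈) with Unchanged? φ′ (R , t)
  ...   | yes o∈′ = start-boundary o∈′
  ...   | no o-changed = contradiction (proj₂ (absorb o∈ o-changed ≤-refl (≤-trans (<⇒≤ L<R) (m≤m+n R t))))
                                       (<⇒≱ (start<end-objectsFrom pos o∈))

  exact-tilings : All (0 <_) φ′ → sum φ′ ≡ M →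
    sizesIn φ L R ⊑ φ × sizesIn φ′ L R ⊑ φ′ × sum (sizesIn φ L R) ≡ sum (sizesIn φ′ L R)
  exact-tilings pos′ sum-φ′ with sizesIn-between pos L-boundary R-boundary L<R
                               | sizesIn-between pos′ L-boundary′ (R-boundary′ sum-φ′) L<R
  ... | X⊑φ , L+X≡R | Y⊑φ′ , L+Y≡R = X⊑φ , Y⊑φ′ , +-cancelˡ-≡ L _ _ (trans L+X≡R (sym L+Y≡R))

-- Size profiles

module Profile (M a b c d i j : ℕ) .{{_ : NonZero b}} where

  h f : ℕ
  h = hCount M a b c d i j
  f = fingerSize M a b c d i j

  -- profile M a b c d i j is definitionally expand runs.
  runs : List (ℕ × ℕ)
  runs = (i , a) ∷ (j , c) ∷ (h , b) ∷ (1 , f) ∷ []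

  module _ (fits : i * a + j * c + d ≤ M) where
    open ≡-Reasoning

    free : ℕ
    free = M ∸ (i * a + j * c + d)

    h*b≤free : h * b ≤ free
    h*b≤free = subst (h * b ≤_) free≡ (m/n*n≤m (M ∸ d ∸ i * a ∸ j * c) b)
      where
      free≡ : M ∸ d ∸ i * a ∸ j * c ≡ free
      free≡ = begin
        M ∸ d ∸ i * a ∸ j * c        ≡⟨ ∸-+-assoc (M ∸ d) (i * a) (j * c) ⟩
        M ∸ d ∸ (i * a + j * c)      ≡⟨ ∸-+-assoc M d (i * a + j * c) ⟩
        M ∸ (d + (i * a + j * c))    ≡⟨ cong (M ∸_) (+-comm d (i * a + j * c)) ⟩
        free                         ∎

    finger≡ : f ≡ free ∸ h * b + d
    finger≡ = begin
      M ∸ i * a ∸ j * c ∸ h * b      ≡⟨ cong (_∸ h * b) (∸-+-assoc M (i * a) (j * c)) ⟩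
      M ∸ (i * a + j * c) ∸ h * b    ≡⟨ cong (_∸ h * b) (sym (m∸n+n≡m d≤rest)) ⟩
      M ∸ (i * a + j * c) ∸ d + d ∸ h * b
                                     ≡⟨ cong (λ x → x + d ∸ h * b) (∸-+-assoc M (i * a + j * c) d) ⟩
      free + d ∸ h * b               ≡⟨ +-∸-comm d h*b≤free ⟩
      free ∸ h * b + d               ∎
      where
      d≤rest : d ≤ M ∸ (i * a + j * c)
      d≤rest = subst (_≤ M ∸ (i * a + j * c)) (m+n∸m≡n (i * a + j * c) d) (∸-monoˡ-≤ (i * a + j * c) fits)

    d≤finger : d ≤ f
    d≤finger = subst (d ≤_) (sym finger≡) (m≤n+m d _)

    sum-runs : i * a + (j * c + (h * b + (1 * f + 0))) ≡ M
    sum-runs = begin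
      i * a + (j * c + (h * b + (1 * f + 0)))        ≡⟨ cong (λ x → i * a + (j * c + (h * b + x))) (trans (+-identityʳ (1 * f)) (*-identityˡ f)) ⟩
      i * a + (j * c + (h * b + f))                  ≡⟨ cong (λ x → i * a + (j * c + (h * b + x))) finger≡ ⟩
      i * a + (j * c + (h * b + (free ∸ h * b + d)))  ≡⟨ regroup (i * a) (j * c) (h * b) (free ∸ h * b) d ⟩
      i * a + j * c + d + (h * b + (free ∸ h * b))   ≡⟨ cong (_+_ (i * a + j * c + d)) (m+[n∸m]≡n h*b≤free) ⟩
      i * a + j * c + d + free                       ≡⟨ m+[n∸m]≡n fits ⟩
      M                                              ∎
      where
      regroup : ∀ x y z w v → x + (y + (z + (w + v))) ≡ x + y + v + (z + w)
      regroup = solve-∀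

-- Distinct combinations

combination : (a b c d : ℕ) → ℤ → ℤ → ℕ → ℕ → ℤ
combination a b c d k₁ k₂ k₃ k₄ = (k₁ *ℤ (+ a)) +ℤ (k₂ *ℤ (+ b)) +ℤ ((+ k₃) *ℤ (+ c)) +ℤ ((+ k₄) *ℤ (+ d))

Distinct : (P Q a b c d : ℕ) → Set
Distinct P Q a b c d = ∀ (k₁ k₂ l₁ l₂ : ℤ) (k₃ k₄ l₃ l₄ : ℕ) →
  ∣ k₁ ∣ ≤ 3 * P → ∣ k₂ ∣ ≤ 3 * P → k₃ ≤ 2 * Q → k₄ ≤ 1 →
  ∣ l₁ ∣ ≤ 3 * P → ∣ l₂ ∣ ≤ 3 * P → l₃ ≤ 2 * Q → l₄ ≤ 1 →
  combination a b c d k₁ k₂ k₃ k₄ ≡ combination a b c d l₁ l₂ l₃ l₄ →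
  (k₁ ≡ l₁) × (k₂ ≡ l₂) × (k₃ ≡ l₃) × (k₄ ≡ l₄)

combination-ℕ : ∀ a b c d k₁ k₂ k₃ k₄ →
  combination a b c d (+ k₁) (+ k₂) k₃ k₄ ≡ + (k₁ * a + k₂ * b + k₃ * c + k₄ * d)
combination-ℕ a b c d k₁ k₂ k₃ k₄ = sym (begin
  + (k₁ * a + k₂ * b + k₃ * c + k₄ * d)                  ≡⟨ pos-+ (k₁ * a + k₂ * b + k₃ * c) (k₄ * d) ⟩
  + (k₁ * a + k₂ * b + k₃ * c) +ℤ + (k₄ * d)             ≡⟨ cong (_+ℤ + (k₄ * d)) (pos-+ (k₁ * a + k₂ * b) (k₃ * c)) ⟩
  + (k₁ * a + k₂ * b) +ℤ + (k₃ * c) +ℤ + (k₄ * d)        ≡⟨ cong (λ x → x +ℤ + (k₃ * c) +ℤ + (k₄ * d)) (pos-+ (k₁ * a) (k₂ * b)) ⟩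
  + (k₁ * a) +ℤ + (k₂ * b) +ℤ + (k₃ * c) +ℤ + (k₄ * d)   ≡⟨ cong₂ (λ x y → x +ℤ y +ℤ + (k₃ * c) +ℤ + (k₄ * d)) (pos-* k₁ a) (pos-* k₂ b) ⟩
  (+ k₁ *ℤ + a) +ℤ (+ k₂ *ℤ + b) +ℤ + (k₃ * c) +ℤ + (k₄ * d)
                                                         ≡⟨ cong₂ (λ x y → (+ k₁ *ℤ + a) +ℤ (+ k₂ *ℤ + b) +ℤ x +ℤ y) (pos-* k₃ c) (pos-* k₄ d) ⟩
  combination a b c d (+ k₁) (+ k₂) k₃ k₄ ∎)
  where open ≡-Reasoning

combination-move-b : ∀ a b c d k₁ k₂ k₃ w P Q → k₁ * a + k₂ * b + k₃ * c + w * b ≡ P * a + Q * c + d →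
  combination a b c d (+ k₁) (+ k₂) k₃ 0 ≡ combination a b c d (+ P) (- (+ w)) Q 1
combination-move-b a b c d k₁ k₂ k₃ w P Q eq = begin
  combination a b c d (+ k₁) (+ k₂) k₃ 0                                ≡⟨ add-sub _ (+ w *ℤ + b) ⟩
  combination a b c d (+ k₁) (+ k₂) k₃ 0 +ℤ (+ w *ℤ + b) - (+ w *ℤ + b)  ≡⟨ cong (_- (+ w *ℤ + b)) lifted ⟩
  combination a b c d (+ P) (+ 0) Q 1 - (+ w *ℤ + b)                    ≡⟨ sub-b (+ P) (+ Q) (+ 1) (+ w) (+ a) (+ b) (+ c) (+ d) ⟩
  combination a b c d (+ P) (- (+ w)) Q 1                               ∎
  where
  open ≡-Reasoning
  add-sub : ∀ x y → x ≡ x +ℤ y - y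
  add-sub = ℤ-Solver.solve-∀
  sub-b : ∀ p q e W A B C D →
    p *ℤ A +ℤ (+ 0) *ℤ B +ℤ q *ℤ C +ℤ e *ℤ D - W *ℤ B ≡ p *ℤ A +ℤ (- W) *ℤ B +ℤ q *ℤ C +ℤ e *ℤ D
  sub-b = ℤ-Solver.solve-∀
  pad : ∀ P a b Q c d → P * a + Q * c + d ≡ P * a + 0 * b + Q * c + 1 * d
  pad = solve-∀
  lifted : combination a b c d (+ k₁) (+ k₂) k₃ 0 +ℤ (+ w *ℤ + b) ≡ combination a b c d (+ P) (+ 0) Q 1
  lifted = begin
    combination a b c d (+ k₁) (+ k₂) k₃ 0 +ℤ (+ w *ℤ + b)  ≡⟨ cong₂ _+ℤ_ (combination-ℕ a b c d k₁ k₂ k₃ 0) (sym (pos-* w b)) ⟩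
    + (k₁ * a + k₂ * b + k₃ * c + 0) +ℤ + (w * b)          ≡⟨ sym (pos-+ _ (w * b)) ⟩
    + (k₁ * a + k₂ * b + k₃ * c + 0 + w * b)               ≡⟨ cong +_ (trans (cong (_+ w * b) (+-identityʳ _)) eq) ⟩
    + (P * a + Q * c + d)                                  ≡⟨ cong +_ (pad P a b Q c d) ⟩
    + (P * a + 0 * b + Q * c + 1 * d)                      ≡⟨ sym (combination-ℕ a b c d P 0 Q 1) ⟩
    combination a b c d (+ P) (+ 0) Q 1                    ∎

module DistinctCombinations (P Q a b c d : ℕ) (distinct : Distinct P Q a b c d) where

  private
    ≤P⇒≤3P : ∀ {x} → x ≤ P → x ≤ 3 * P
    ≤P⇒≤3P x≤P = ≤-trans x≤P (m≤m+n P _)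
    ≤Q⇒≤2Q : ∀ {x} → x ≤ Q → x ≤ 2 * Q
    ≤Q⇒≤2Q x≤Q = ≤-trans x≤Q (m≤m+n Q _)

  counts-unique : ∀ {xa xb xc ya yb yc} → xa ≤ P → xb ≤ 3 * P → xc ≤ Q → ya ≤ P → yb ≤ 3 * P → yc ≤ Q →
    xa * a + xb * b + xc * c ≡ ya * a + yb * b + yc * c → xa ≡ ya × xb ≡ yb × xc ≡ yc
  counts-unique {xa} {xb} {xc} {ya} {yb} {yc} xa≤ xb≤ xc≤ ya≤ yb≤ yc≤ eq =
    let xa≡ya , xb≡yb , xc≡yc , _ = distinct (+ xa) (+ xb) (+ ya) (+ yb) xc 0 yc 0
          (≤P⇒≤3P xa≤) xb≤ (≤Q⇒≤2Q xc≤) z≤n (≤P⇒≤3P ya≤) yb≤ (≤Q⇒≤2Q yc≤) z≤n lifted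
    in +-injective xa≡ya , +-injective xb≡yb , xc≡yc
    where
    lifted : combination a b c d (+ xa) (+ xb) xc 0 ≡ combination a b c d (+ ya) (+ yb) yc 0
    lifted = trans (combination-ℕ a b c d xa xb xc 0)
                   (trans (cong (λ x → + (x + 0)) eq) (sym (combination-ℕ a b c d ya yb yc 0)))

  combination≢memSize : ∀ {k₁ k₂ k₃ w} → k₁ ≤ 3 * P → k₂ ≤ 3 * P → k₃ ≤ 2 * Q → w ≤ 3 * P →
    k₁ * a + k₂ * b + k₃ * c + w * b ≢ P * a + Q * c + d
  combination≢memSize {k₁} {k₂} {k₃} {w} k₁≤ k₂≤ k₃≤ w≤ eq
    with distinct (+ k₁) (+ k₂) (+ P) (- (+ w)) k₃ 0 Q 1 k₁≤ k₂≤ k₃≤ z≤n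
                  (≤P⇒≤3P ≤-refl) (subst (_≤ 3 * P) (sym (∣-i∣≡∣i∣ (+ w))) w≤) (≤Q⇒≤2Q ≤-refl) ≤-refl
                  (combination-move-b a b c d k₁ k₂ k₃ w P Q eq)
  ... | _ , _ , _ , ()

-- Sub-multisets of profiles

weight-with-complement : ∀ {xa xb xc ya yb yc i j h a b c z N} → ya ≤ i → yc ≤ j → yb ≤ h →
  xa * a + (xc * c + (xb * b + 0)) ≡ ya * a + (yc * c + (yb * b + z)) →
  i * a + (j * c + (h * b + z)) ≡ N →
  (xa + (i ∸ ya)) * a + xb * b + (xc + (j ∸ yc)) * c + (h ∸ yb) * b ≡ N
weight-with-complement {xa} {xb} {xc} {ya} {yb} {yc} {i} {j} {h} {a} {b} {c} {z} ya≤i yc≤j yb≤h X≡Y profile≡N = begin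
  (xa + u) * a + xb * b + (xc + v) * c + w * b          ≡⟨ split xa u a xb b xc v c w ⟩
  xa * a + (xc * c + (xb * b + 0)) + (u * a + (v * c + w * b))
                                                        ≡⟨ cong (_+ (u * a + (v * c + w * b))) X≡Y ⟩
  ya * a + (yc * c + (yb * b + z)) + (u * a + (v * c + w * b))
                                                        ≡⟨ merge ya u a yc v c yb w b z ⟩
  (ya + u) * a + ((yc + v) * c + ((yb + w) * b + z))    ≡⟨ cong₂ (λ p q → p * a + q) (m+[n∸m]≡n ya≤i)
                                                             (cong₂ (λ p q → p * c + q) (m+[n∸m]≡n yc≤j)
                                                               (cong (λ p → p * b + z) (m+[n∸m]≡n yb≤h))) ⟩
  i * a + (j * c + (h * b + z))                         ≡⟨ profile≡N ⟩
  _                                                     ∎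
  where
  open ≡-Reasoning
  u v w : ℕ
  u = i ∸ ya
  v = j ∸ yc
  w = h ∸ yb
  split : ∀ xa u a xb b xc v c w →
    (xa + u) * a + xb * b + (xc + v) * c + w * b ≡ xa * a + (xc * c + (xb * b + 0)) + (u * a + (v * c + w * b))
  split = solve-∀
  merge : ∀ ya u a yc v c yb w b z →
    ya * a + (yc * c + (yb * b + z)) + (u * a + (v * c + w * b)) ≡ (ya + u) * a + ((yc + v) * c + ((yb + w) * b + z))
  merge = solve-∀

module MemoryProfiles {P Q a b c d : ℕ} .{{_ : NonZero b}} (Q≤P : Q ≤ P) (0<a : 0 < a) (a<b : a < b) (b<c : b < c)
                      (c<d : c < d) (d≤2a : d ≤ 2 * a) where

  private
    M : ℕ
    M = memSize P Q a c d

    reorder : ∀ x a y c z b → x * a + (y * c + (z * b + 0)) ≡ x * a + z * b + y * c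
    reorder = solve-∀

  fits : ∀ {i j} → i ≤ P → j ≤ Q → i * a + j * c + d ≤ M
  fits i≤P j≤Q = +-monoˡ-≤ d (+-mono-≤ (*-monoˡ-≤ a i≤P) (*-monoˡ-≤ c j≤Q))

  hCount≤3P : ∀ i j → hCount M a b c d i j ≤ 3 * P
  hCount≤3P i j = *-cancelʳ-≤ (hCount M a b c d i j) (3 * P) b (begin
    hCount M a b c d i j * b        ≤⟨ m/n*n≤m (M ∸ d ∸ i * a ∸ j * c) b ⟩
    M ∸ d ∸ i * a ∸ j * c           ≤⟨ ≤-trans (m∸n≤m _ (j * c)) (m∸n≤m _ (i * a)) ⟩
    M ∸ d                           ≡⟨ m+n∸n≡m (P * a + Q * c) d ⟩
    P * a + Q * c                   ≤⟨ +-mono-≤ (*-monoʳ-≤ P (<⇒≤ a<b)) (*-monoʳ-≤ Q c≤2b) ⟩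
    P * b + Q * (2 * b)             ≡⟨ collect P Q b ⟩
    (P + 2 * Q) * b                 ≤⟨ *-monoˡ-≤ b (+-monoʳ-≤ P (*-monoʳ-≤ 2 Q≤P)) ⟩
    3 * P * b                       ∎)
    where
    open ≤-Reasoning
    c≤2b : c ≤ 2 * b
    c≤2b = ≤-trans (<⇒≤ (<-≤-trans c<d d≤2a)) (*-monoʳ-≤ 2 (<⇒≤ a<b))
    collect : ∀ P Q b → P * b + Q * (2 * b) ≡ (P + 2 * Q) * b
    collect = solve-∀

  module _ {i j : ℕ} (i≤P : i ≤ P) (j≤Q : j ≤ Q) {φ : List ℕ} (φ↭ : HasProfile φ (profile M a b c d i j)) where
    open Profile M a b c d i j

    memory-positive : All (0 <_) φ
    memory-positive = All-resp-↭ (↭-sym φ↭) (All-expand runs (0<a ∷ 0<c ∷ 0<b ∷ 0<f ∷ []))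
      where
      0<b : 0 < b
      0<b = <-trans 0<a a<b
      0<c : 0 < c
      0<c = <-trans 0<b b<c
      0<f : 0 < f
      0<f = <-≤-trans (<-trans 0<c c<d) (d≤finger (fits i≤P j≤Q))

    memory-sum : sum φ ≡ M
    memory-sum = trans (sum-↭ φ↭) (trans (sum-expand runs) (sum-runs (fits i≤P j≤Q)))

  module _ (distinct : Distinct P Q a b c d) where
    open DistinctCombinations P Q a b c d distinct

    sub-profiles-↭ : ∀ {i j i′ j′ X Y} → i ≤ P → j ≤ Q → i′ ≤ P → j′ ≤ Q →
      X ⊑ profile M a b c d i j → fingerSize M a b c d i j ∉ X → Y ⊑ profile M a b c d i′ j′ →
      sum X ≡ sum Y → Y ↭ X
    sub-profiles-↭ {i} {j} {i′} {j′} {X} {Y} i≤P j≤Q i′≤P j′≤Q X⊑ f∉X Y⊑ X≡Y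
      with ⊑-expand (Profile.runs M a b c d i j) X⊑ | ⊑-expand (Profile.runs M a b c d i′ j′) Y⊑
    ... | xs@((xa , _) ∷ (xc , _) ∷ (xb , _) ∷ (xf , _) ∷ []) , (xa≤i , refl) ∷ (xc≤j , refl) ∷ (xb≤h , refl) ∷ (xf≤1 , refl) ∷ [] , X↭
        | ys@((ya , _) ∷ (yc , _) ∷ (yb , _) ∷ (yf , _) ∷ []) , (ya≤i′ , refl) ∷ (yc≤j′ , refl) ∷ (yb≤h′ , refl) ∷ (yf≤1 , refl) ∷ [] , Y↭
      with xf≤1 | yf≤1
    ... | s≤s z≤n | _ = contradiction f∈X f∉X
      where
      f∈X : fingerSize M a b c d i j ∈ X
      f∈X = ∈-resp-↭ (↭-sym X↭) (∈-++⁺ʳ (replicate xa a) (∈-++⁺ʳ (replicate xc c) (∈-++⁺ʳ (replicate xb b) (here refl))))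
    ... | z≤n | s≤s z≤n = ⊥-elim (combination≢memSize k₁≤ k₂≤ k₃≤ w≤
          (weight-with-complement {xa} {xb} {xc} ya≤i′ yc≤j′ yb≤h′ weights
            (Profile.sum-runs M a b c d i′ j′ (fits i′≤P j′≤Q))))
      where
      weights : xa * a + (xc * c + (xb * b + 0)) ≡ ya * a + (yc * c + (yb * b + (1 * fingerSize M a b c d i′ j′ + 0)))
      weights = trans (sym (sum-↭-expand xs X↭)) (trans X≡Y (sum-↭-expand ys Y↭))
      k₁≤ : xa + (i′ ∸ ya) ≤ 3 * P
      k₁≤ = ≤-trans (+-mono-≤ (≤-trans xa≤i i≤P) (≤-trans (m∸n≤m i′ ya) i′≤P)) (+-monoʳ-≤ P (m≤m+n P _))
      k₂≤ : xb ≤ 3 * P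
      k₂≤ = ≤-trans xb≤h (hCount≤3P i j)
      k₃≤ : xc + (j′ ∸ yc) ≤ 2 * Q
      k₃≤ = ≤-trans (+-mono-≤ (≤-trans xc≤j j≤Q) (≤-trans (m∸n≤m j′ yc) j′≤Q)) (+-monoʳ-≤ Q (m≤m+n Q 0))
      w≤ : hCount M a b c d i′ j′ ∸ yb ≤ 3 * P
      w≤ = ≤-trans (m∸n≤m _ yb) (hCount≤3P i′ j′)
    ... | z≤n | z≤n
      with counts-unique (≤-trans xa≤i i≤P) (≤-trans xb≤h (hCount≤3P i j)) (≤-trans xc≤j j≤Q)
             (≤-trans ya≤i′ i′≤P) (≤-trans yb≤h′ (hCount≤3P i′ j′)) (≤-trans yc≤j′ j′≤Q)
             (trans (sym (reorder xa a xc c xb b))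
               (trans (trans (sym (sum-↭-expand xs X↭)) (trans X≡Y (sum-↭-expand ys Y↭)))
                 (reorder ya a yc c yb b)))
    ... | refl , refl , refl = ↭-trans Y↭ (↭-sym X↭)

lemma5p13 : (P Q a b c d : ℕ) → .{{_ : NonZero b}} →
    Q < P → 1 ≤ Q →
    0 < a → a < b → b < c → c < d → d ≤ 2 * a →
    (∀ (k₁ k₂ l₁ l₂ : ℤ) (k₃ k₄ l₃ l₄ : ℕ) →
      ∣ k₁ ∣ ≤ 3 * P → ∣ k₂ ∣ ≤ 3 * P → k₃ ≤ 2 * Q → k₄ ≤ 1 →
      ∣ l₁ ∣ ≤ 3 * P → ∣ l₂ ∣ ≤ 3 * P → l₃ ≤ 2 * Q → l₄ ≤ 1 →
      (k₁ *ℤ (+ a)) +ℤ (k₂ *ℤ (+ b)) +ℤ ((+ k₃) *ℤ (+ c)) +ℤ ((+ k₄) *ℤ (+ d))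
        ≡ (l₁ *ℤ (+ a)) +ℤ (l₂ *ℤ (+ b)) +ℤ ((+ l₃) *ℤ (+ c)) +ℤ ((+ l₄) *ℤ (+ d)) →
      (k₁ ≡ l₁) × (k₂ ≡ l₂) × (k₃ ≡ l₃) × (k₄ ≡ l₄)) →
    (i j i' j' : ℕ) → i ≤ P → j ≤ Q → i' ≤ P → j' ≤ Q →
    (φ φ' : List ℕ) →
    HasProfile φ (profile (memSize P Q a c d) a b c d i j) →
    HasProfile φ' (profile (memSize P Q a c d) a b c d i' j') →
    (L R : ℕ) →
    MaximalChangedInterval (memSize P Q a c d) φ φ' L R →
    ¬ ContainsFinger φ (fingerSize (memSize P Q a c d) a b c d i j) L R →
    sizesIn φ' L R ↭ sizesIn φ L R
lemma5p13 P Q a b c d Q<P _ 0<a a<b b<c c<d d≤2a distinct i j i′ j′ i≤P j≤Q i′≤P j′≤Q φ φ′ φ↭ φ′↭ L R maximal no-finger =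
  let X⊑φ , Y⊑φ′ , X≡Y = exact-tilings (memory-positive i≤P j≤Q φ↭) (memory-sum i≤P j≤Q φ↭) maximal
                                       (memory-positive i′≤P j′≤Q φ′↭) (memory-sum i′≤P j′≤Q φ′↭)
  in sub-profiles-↭ distinct i≤P j≤Q i′≤P j′≤Q (⊑-respʳ-↭ X⊑φ φ↭) (no-finger ∘ ∈-sizesIn⁻) (⊑-respʳ-↭ Y⊑φ′ φ′↭) X≡Y
  where open MemoryProfiles (<⇒≤ Q<P) 0<a a<b b<c c<d d≤2a
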